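{- Let $H_4$ be the 4-gate (defined in the context) and let $x,y$ be two distinct vertices of $H_4$ chosen from its attachment vertices $\{1,2,9,11\}$. Then $H_4$ contains a Hamiltonian path (a path visiting every one of its 11 vertices exactly once) with endpoints $x$ and $y$. Equivalently, one can enter the 4-gate via any external edge and exit via any other external edge, visiting every vertex of the 4-gate exactly once.
   Context: The 4-gate $H_4$ is the simple undirected graph on vertex set $\{1,\dots,11\}$ with the 14 edges $\{1,3\},\{1,8\},\{2,3\},\{2,5\},\{3,4\},\{4,5\},\{4,6\},\{6,7\},\{7,8\},\{7,10\},\{8,9\},\{9,10\},\{10,11\},\{5,11\}$. When the 4-gate is used inside a larger graph it has four external edges, one incident to each of the attachment vertices $1,2,9,11$ (and leading outside the gate). -}

module Defs where

open import Data.Nat using (ℕ; _≤_)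
open import Data.Product using (_×_; _,_)
open import Data.List using (List; []; _∷_)
open import Data.List.Membership.Propositional using (_∈_)
open import Data.List.Relation.Unary.All using (All)
open import Data.List.Relation.Unary.Unique.Propositional using (Unique)
open import Relation.Binary.PropositionalEquality using (_≡_)
open import Data.Sum using (_⊎_)

IsVertex : ℕ → Set
IsVertex v = 1 ≤ v × v ≤ 11

edgesH4 : List (ℕ × ℕ)
edgesH4 = (1 , 3) ∷ (1 , 8) ∷ (2 , 3) ∷ (2 , 5) ∷ (3 , 4) ∷ (4 , 5) ∷ (4 , 6)
        ∷ (6 , 7) ∷ (7 , 8) ∷ (7 , 10) ∷ (8 , 9) ∷ (9 , 10) ∷ (10 , 11) ∷ (5 , 11) ∷ []

Adj : ℕ → ℕ → Set
Adj u v = ((u , v) ∈ edgesH4) ⊎ ((v , u) ∈ edgesH4)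

data Walk : List ℕ → Set where
  walk-[]  : Walk []
  walk-one : ∀ {v} → Walk (v ∷ [])
  walk-∷   : ∀ {u v vs} → Adj u v → Walk (v ∷ vs) → Walk (u ∷ v ∷ vs)

data StartsEnds : List ℕ → ℕ → ℕ → Set where
  se-one : ∀ {x} → StartsEnds (x ∷ []) x x
  se-∷   : ∀ {x v vs y} → StartsEnds (v ∷ vs) v y → StartsEnds (x ∷ v ∷ vs) x y

HamPathH4 : ℕ → ℕ → List ℕ → Set
HamPathH4 x y p =
  Walk p × Unique p × All IsVertex p
  × (∀ v → IsVertex v → v ∈ p) × StartsEnds p x y

Attachment : ℕ → Set
Attachment v = v ≡ 1 ⊎ v ≡ 2 ⊎ v ≡ 9 ⊎ v ≡ 11

-- Each of the twelve ordered pairs of attachment vertices is joined by an explicit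
-- Hamiltonian path; being a Hamiltonian path of H₄ is decidable, so each witness
-- is certified by evaluating the decision procedure.

module Submission where

open import Defs
open import Data.Nat using (ℕ; suc; s≤s; z≤n; _≤?_)
open import Data.Nat.Properties using (_≟_)
open import Data.Product using (Σ; _,_)
open import Data.Product.Properties using (≡-dec)
open import Data.List using (List; []; _∷_; applyUpTo)
open import Data.List.Relation.Unary.All as All using (all?)
open import Data.List.Relation.Unary.Unique.DecPropositional _≟_ using (unique?)
open import Data.List.Membership.Propositional using (_∈_)
open import Data.List.Membership.Propositional.Properties using (∈-applyUpTo⁺; ∈-applyUpTo⁻)
open import Data.List.Membership.DecPropositional _≟_ using (_∈?_)
import Data.List.Membership.DecPropositional as DecMembership
open import Data.Sum using (inj₁; inj₂)
open import Data.Empty using (⊥-elim)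
open import Relation.Binary.PropositionalEquality using (_≡_; refl)
open import Relation.Nullary using (¬_; Dec; yes; no)
open import Relation.Nullary.Decidable using (True; toWitness; map′; _×-dec_; _⊎-dec_)

module EdgeMembership = DecMembership (≡-dec _≟_ _≟_)

adj? : ∀ u v → Dec (Adj u v)
adj? u v = ((u , v) EdgeMembership.∈? edgesH4) ⊎-dec ((v , u) EdgeMembership.∈? edgesH4)

walk? : ∀ p → Dec (Walk p)
walk? []           = yes walk-[]
walk? (v ∷ [])     = yes walk-one
walk? (u ∷ v ∷ vs) with adj? u v | walk? (v ∷ vs)
... | yes uv | yes w  = yes (walk-∷ uv w)
... | no ¬uv | _      = no λ { (walk-∷ uv _) → ¬uv uv }
... | yes _  | no ¬w  = no λ { (walk-∷ _ w) → ¬w w }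

startsEnds? : ∀ p x y → Dec (StartsEnds p x y)
startsEnds? []           x y = no λ ()
startsEnds? (u ∷ [])     x y with u ≟ x | u ≟ y
... | yes refl | yes refl = yes se-one
... | no u≢x   | _        = no λ { se-one → u≢x refl }
... | yes _    | no u≢y   = no λ { se-one → u≢y refl }
startsEnds? (u ∷ v ∷ vs) x y with u ≟ x | startsEnds? (v ∷ vs) v y
... | yes refl | yes se = yes (se-∷ se)
... | no u≢x   | _      = no λ { (se-∷ _) → u≢x refl }
... | yes _    | no ¬se = no λ { (se-∷ se) → ¬se se }

isVertex? : ∀ v → Dec (IsVertex v)
isVertex? v = (1 ≤? v) ×-dec (v ≤? 11)

vertices : List ℕ
vertices = applyUpTo suc 11

isVertex⇒∈vertices : ∀ {v} → IsVertex v → v ∈ vertices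
isVertex⇒∈vertices {suc i} (_ , i<11) = ∈-applyUpTo⁺ suc i<11

∈vertices⇒isVertex : ∀ {v} → v ∈ vertices → IsVertex v
∈vertices⇒isVertex v∈ with _ , i<11 , refl ← ∈-applyUpTo⁻ suc v∈ = s≤s z≤n , i<11

covers? : ∀ p → Dec (∀ v → IsVertex v → v ∈ p)
covers? p = map′
  (λ all∈ v v-vertex → All.lookup all∈ (isVertex⇒∈vertices v-vertex))
  (λ covers → All.tabulate λ v∈ → covers _ (∈vertices⇒isVertex v∈))
  (all? (_∈? p) vertices)

hamPathH4? : ∀ x y p → Dec (HamPathH4 x y p)
hamPathH4? x y p =
  walk? p ×-dec unique? p ×-dec all? isVertex? p ×-dec covers? p ×-dec startsEnds? p x y

hamPathH4 : ∀ x y p → {True (hamPathH4? x y p)} → Σ (List ℕ) (λ q → HamPathH4 x y q)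
hamPathH4 x y p {certified} = p , toWitness certified

lemma3p1 : (x y : ℕ) → Attachment x → Attachment y → ¬ (x ≡ y)
    → Σ (List ℕ) (λ p → HamPathH4 x y p)
lemma3p1 _ _ (inj₁ refl)               (inj₂ (inj₁ refl))        _ = hamPathH4 1 2 (1 ∷ 3 ∷ 4 ∷ 6 ∷ 7 ∷ 8 ∷ 9 ∷ 10 ∷ 11 ∷ 5 ∷ 2 ∷ [])
lemma3p1 _ _ (inj₁ refl)               (inj₂ (inj₂ (inj₁ refl))) _ = hamPathH4 1 9 (1 ∷ 8 ∷ 7 ∷ 6 ∷ 4 ∷ 3 ∷ 2 ∷ 5 ∷ 11 ∷ 10 ∷ 9 ∷ [])
lemma3p1 _ _ (inj₁ refl)               (inj₂ (inj₂ (inj₂ refl))) _ = hamPathH4 1 11 (1 ∷ 8 ∷ 9 ∷ 10 ∷ 7 ∷ 6 ∷ 4 ∷ 3 ∷ 2 ∷ 5 ∷ 11 ∷ [])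
lemma3p1 _ _ (inj₂ (inj₁ refl))        (inj₁ refl)               _ = hamPathH4 2 1 (2 ∷ 5 ∷ 11 ∷ 10 ∷ 9 ∷ 8 ∷ 7 ∷ 6 ∷ 4 ∷ 3 ∷ 1 ∷ [])
lemma3p1 _ _ (inj₂ (inj₁ refl))        (inj₂ (inj₂ (inj₁ refl))) _ = hamPathH4 2 9 (2 ∷ 3 ∷ 1 ∷ 8 ∷ 7 ∷ 6 ∷ 4 ∷ 5 ∷ 11 ∷ 10 ∷ 9 ∷ [])
lemma3p1 _ _ (inj₂ (inj₁ refl))        (inj₂ (inj₂ (inj₂ refl))) _ = hamPathH4 2 11 (2 ∷ 3 ∷ 1 ∷ 8 ∷ 9 ∷ 10 ∷ 7 ∷ 6 ∷ 4 ∷ 5 ∷ 11 ∷ [])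
lemma3p1 _ _ (inj₂ (inj₂ (inj₁ refl))) (inj₁ refl)               _ = hamPathH4 9 1 (9 ∷ 10 ∷ 11 ∷ 5 ∷ 2 ∷ 3 ∷ 4 ∷ 6 ∷ 7 ∷ 8 ∷ 1 ∷ [])
lemma3p1 _ _ (inj₂ (inj₂ (inj₁ refl))) (inj₂ (inj₁ refl))        _ = hamPathH4 9 2 (9 ∷ 8 ∷ 1 ∷ 3 ∷ 4 ∷ 6 ∷ 7 ∷ 10 ∷ 11 ∷ 5 ∷ 2 ∷ [])
lemma3p1 _ _ (inj₂ (inj₂ (inj₁ refl))) (inj₂ (inj₂ (inj₂ refl))) _ = hamPathH4 9 11 (9 ∷ 8 ∷ 1 ∷ 3 ∷ 2 ∷ 5 ∷ 4 ∷ 6 ∷ 7 ∷ 10 ∷ 11 ∷ [])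
lemma3p1 _ _ (inj₂ (inj₂ (inj₂ refl))) (inj₁ refl)               _ = hamPathH4 11 1 (11 ∷ 10 ∷ 9 ∷ 8 ∷ 7 ∷ 6 ∷ 4 ∷ 5 ∷ 2 ∷ 3 ∷ 1 ∷ [])
lemma3p1 _ _ (inj₂ (inj₂ (inj₂ refl))) (inj₂ (inj₁ refl))        _ = hamPathH4 11 2 (11 ∷ 5 ∷ 4 ∷ 6 ∷ 7 ∷ 10 ∷ 9 ∷ 8 ∷ 1 ∷ 3 ∷ 2 ∷ [])
lemma3p1 _ _ (inj₂ (inj₂ (inj₂ refl))) (inj₂ (inj₂ (inj₁ refl))) _ = hamPathH4 11 9 (11 ∷ 10 ∷ 7 ∷ 6 ∷ 4 ∷ 5 ∷ 2 ∷ 3 ∷ 1 ∷ 8 ∷ 9 ∷ [])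
lemma3p1 _ _ (inj₁ refl)               (inj₁ refl)               x≢y = ⊥-elim (x≢y refl)
lemma3p1 _ _ (inj₂ (inj₁ refl))        (inj₂ (inj₁ refl))        x≢y = ⊥-elim (x≢y refl)
lemma3p1 _ _ (inj₂ (inj₂ (inj₁ refl))) (inj₂ (inj₂ (inj₁ refl))) x≢y = ⊥-elim (x≢y refl)
lemma3p1 _ _ (inj₂ (inj₂ (inj₂ refl))) (inj₂ (inj₂ (inj₂ refl))) x≢y = ⊥-elim (x≢y refl)
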